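{- Let $p$ be a prime and let $L$ be a dephased log-Hadamard matrix over $\mathbb{Z}_p$. Then every log-Hadamard matrix equivalent to $L$ has rank (over $\mathbb{Z}_p$) at least $\operatorname{rank}(L)$.
   Context: A vector with entries in $\mathbb{Z}_p$ is equidistributed if each of the values $0,1,\dots,p-1$ appears the same number of times among its entries. A square matrix with entries in $\mathbb{Z}_p$ is log-Hadamard if the difference of any two distinct rows is an equidistributed vector. A log-Hadamard matrix is dephased if all entries of its first row and its first column are zero. Two log-Hadamard matrices are equivalent if one can be transformed into the other by (repeatedly) adding the all-one vector $(1,\dots,1)$ to rows, adding the all-one vector $(1,\dots,1)^T$ to columns, and permuting rows and columns. -}

module Defs where

open import Data.Nat using (ℕ; zero; suc; NonZero; _∸_) renaming (_+_ to _+ℕ_; _*_ to _*ℕ_)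
open import Data.Nat.DivMod using (_mod_)
open import Data.Fin using (Fin; toℕ; _≟_)
open import Data.Fin.Permutation using (Permutation′; _⟨$⟩ʳ_)
open import Data.List using (List; length; filter)
open import Data.List.Base using (allFin)
open import Data.Product using (Σ; _×_)
open import Data.Bool using (if_then_else_)
open import Relation.Nullary using (¬_)
open import Relation.Nullary.Decidable using (⌊_⌋)
open import Relation.Binary.PropositionalEquality using (_≡_; _≢_)
open import Relation.Binary.Construct.Closure.ReflexiveTransitive using (Star)

module _ (p : ℕ) .{{_ : NonZero p}} where

  0ₚ : Fin p
  0ₚ = 0 mod p

  1ₚ : Fin p
  1ₚ = 1 mod p

  _+ₚ_ : Fin p → Fin p → Fin p
  a +ₚ b = (toℕ a +ℕ toℕ b) mod p

  _*ₚ_ : Fin p → Fin p → Fin p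
  a *ₚ b = (toℕ a *ℕ toℕ b) mod p

  _-ₚ_ : Fin p → Fin p → Fin p
  a -ₚ b = (toℕ a +ℕ (p ∸ toℕ b)) mod p

  sumₚ : ∀ {r} → (Fin r → Fin p) → Fin p
  sumₚ {zero}  f = 0ₚ
  sumₚ {suc r} f = f Fin.zero +ₚ sumₚ (λ i → f (Fin.suc i))

  Matrix : ℕ → Set
  Matrix n = Fin n → Fin n → Fin p

  count : ∀ {n} → (Fin n → Fin p) → Fin p → ℕ
  count v a = length (filter (λ k → v k ≟ a) (allFin _))

  Equidistributed : ∀ {n} → (Fin n → Fin p) → Set
  Equidistributed v = ∀ a b → count v a ≡ count v b

  IsLogHadamard : ∀ {n} → Matrix n → Set
  IsLogHadamard L = ∀ i j → i ≢ j → Equidistributed (λ k → L i k -ₚ L j k)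

  Dephased : ∀ {n} → Matrix n → Set
  Dephased L = ∀ i j → (toℕ i ≡ 0 → L i j ≡ 0ₚ) × (toℕ j ≡ 0 → L i j ≡ 0ₚ)

  data Step {n : ℕ} (L M : Matrix n) : Set where
    addRow : (i : Fin n) →
      (∀ r c → M r c ≡ (if ⌊ r ≟ i ⌋ then L r c +ₚ 1ₚ else L r c)) → Step L M
    addCol : (j : Fin n) →
      (∀ r c → M r c ≡ (if ⌊ c ≟ j ⌋ then L r c +ₚ 1ₚ else L r c)) → Step L M
    permRows : (σ : Permutation′ n) →
      (∀ r c → M r c ≡ L (σ ⟨$⟩ʳ r) c) → Step L M
    permCols : (τ : Permutation′ n) →
      (∀ r c → M r c ≡ L r (τ ⟨$⟩ʳ c)) → Step L M

  Equivalent : ∀ {n} → Matrix n → Matrix n → Set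
  Equivalent = Star Step

  RowsIndependent : ∀ {n r} → Matrix n → (Fin r → Fin n) → Set
  RowsIndependent {n} {r} L f =
    ∀ (c : Fin r → Fin p) →
      (∀ k → sumₚ (λ t → c t *ₚ L (f t) k) ≡ 0ₚ) → ∀ t → c t ≡ 0ₚ

  IsRank : ∀ {n} → Matrix n → ℕ → Set
  IsRank {n} L r =
    Σ (Fin r → Fin n) (λ f → RowsIndependent L f) ×
    (∀ (g : Fin (suc r) → Fin n) → ¬ RowsIndependent L g)

module Submission where

-- An equivalence turns L into M with M r c = L (σ r) (τ c) + α r + β c, so k independent rows
-- of L give k rows of M which are the same rows shifted by constants α_t and a common vector β.
-- Because L has a zero column j₀, a dependency c of the shifted rows determines its linear part,
-- Σ c_t L_t = (Σ c)(β_{j₀} − β), and hence Σ c ≠ 0.  If the shifted rows are dependent, with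
-- c_{t₀} ≠ 0, replace row t₀ by the image of the zero first row of L: for a dependency d of the
-- new family, comparing with c gives (Σ c) d_t = (Σ d) c_t for t ≠ t₀ and (Σ d) c_{t₀} = 0, so
-- d = 0 since ℤ_p has no zero divisors.  Either way M has k independent rows.

open import Level using (0ℓ; _⊔_)
open import Data.Nat as ℕ using (ℕ; zero; suc; NonZero; _∸_; _%_; _≤_; _≤′_; _≤?_)
import Data.Nat.Properties as ℕ
open import Data.Nat.DivMod
  using (_mod_; %-distribˡ-+; %-distribˡ-*; m%n%n≡m%n; m<n⇒m%n≡m; n%n≡0)
open import Data.Nat.Primality using (Prime; euclidsLemma)
open import Data.Nat.Divisibility using (_∣_; m%n≡0⇒n∣m; n∣m⇒m%n≡0)
open import Data.Fin as Fin using (Fin; toℕ)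
open import Data.Fin.Properties using (toℕ-injective; toℕ-fromℕ<; toℕ<n)
open import Data.Fin.Permutation as Permutation
  using (Permutation′; _⟨$⟩ʳ_; _⟨$⟩ˡ_; _∘ₚ_; inverseʳ)
open import Data.Vec.Functional using (Vector; updateAt; _∷_)
open import Data.Vec.Functional.Properties using (updateAt-updates; updateAt-minimal)
open import Data.Bool using (true; false; if_then_else_)
open import Data.Product using (Σ-syntax; _,_; proj₁; proj₂)
open import Data.Sum using (_⊎_; inj₁; inj₂; map)
open import Data.Empty using (⊥-elim)
open import Data.Maybe using (nothing)
open import Function using (_∘_; const)
open import Relation.Nullary using (¬_; yes; no)
open import Relation.Nullary.Decidable using (⌊_⌋)
open import Relation.Binary.Definitions using (Decidable)
import Relation.Binary.PropositionalEquality as ≡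
open ≡ using (_≡_; _≢_)
open import Relation.Binary.Construct.Closure.ReflexiveTransitive using (ε; _◅_)
open import Algebra.Bundles using (CommutativeRing)
open import Algebra.Structures using (IsCommutativeRing)
open import Algebra.Consequences.Propositional
  using (comm∧idˡ⇒id; comm∧invˡ⇒inv; comm∧distrʳ⇒distr)
open import Algebra.Solver.Ring.AlmostCommutativeRing
  using (fromCommutativeRing; -raw-almostCommutative⟶)

open import Defs

module ℤ/ (p : ℕ) .{{_ : NonZero p}} where

  open ≡
  open ≡-Reasoning

  infixl 6 _+_
  infixl 7 _*_

  _+_ _*_ : Fin p → Fin p → Fin p
  _+_ = _+ₚ_ p
  _*_ = _*ₚ_ p

  -_ : Fin p → Fin p
  - a = (p ∸ toℕ a) mod p

  toℕ-mod : ∀ m → toℕ (m mod p) ≡ m % p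
  toℕ-mod m = toℕ-fromℕ< _

  toℕ-+ : ∀ a b → toℕ (a + b) ≡ (toℕ a ℕ.+ toℕ b) % p
  toℕ-+ a b = toℕ-mod _

  toℕ-* : ∀ a b → toℕ (a * b) ≡ (toℕ a ℕ.* toℕ b) % p
  toℕ-* a b = toℕ-mod _

  toℕ-% : ∀ (a : Fin p) → toℕ a % p ≡ toℕ a
  toℕ-% a = m<n⇒m%n≡m (toℕ<n a)

  toℕ-0ₚ : toℕ (0ₚ p) ≡ 0
  toℕ-0ₚ = trans (toℕ-mod 0) (m<n⇒m%n≡m (ℕ.>-nonZero⁻¹ p))

  %-absorbˡ-+ : ∀ m n → (m % p ℕ.+ n) % p ≡ (m ℕ.+ n) % p
  %-absorbˡ-+ m n = begin
    (m % p ℕ.+ n) % p          ≡⟨ %-distribˡ-+ (m % p) n p ⟩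
    (m % p % p ℕ.+ n % p) % p  ≡⟨ cong (λ x → (x ℕ.+ n % p) % p) (m%n%n≡m%n m p) ⟩
    (m % p ℕ.+ n % p) % p      ≡⟨ %-distribˡ-+ m n p ⟨
    (m ℕ.+ n) % p              ∎

  %-absorbʳ-+ : ∀ m n → (m ℕ.+ n % p) % p ≡ (m ℕ.+ n) % p
  %-absorbʳ-+ m n = begin
    (m ℕ.+ n % p) % p  ≡⟨ cong (_% p) (ℕ.+-comm m (n % p)) ⟩
    (n % p ℕ.+ m) % p  ≡⟨ %-absorbˡ-+ n m ⟩
    (n ℕ.+ m) % p      ≡⟨ cong (_% p) (ℕ.+-comm n m) ⟩
    (m ℕ.+ n) % p      ∎

  %-absorbˡ-* : ∀ m n → (m % p ℕ.* n) % p ≡ (m ℕ.* n) % p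
  %-absorbˡ-* m n = begin
    (m % p ℕ.* n) % p            ≡⟨ %-distribˡ-* (m % p) n p ⟩
    (m % p % p ℕ.* (n % p)) % p  ≡⟨ cong (λ x → (x ℕ.* (n % p)) % p) (m%n%n≡m%n m p) ⟩
    (m % p ℕ.* (n % p)) % p      ≡⟨ %-distribˡ-* m n p ⟨
    (m ℕ.* n) % p                ∎

  %-absorbʳ-* : ∀ m n → (m ℕ.* (n % p)) % p ≡ (m ℕ.* n) % p
  %-absorbʳ-* m n = begin
    (m ℕ.* (n % p)) % p  ≡⟨ cong (_% p) (ℕ.*-comm m (n % p)) ⟩
    (n % p ℕ.* m) % p    ≡⟨ %-absorbˡ-* n m ⟩
    (n ℕ.* m) % p        ≡⟨ cong (_% p) (ℕ.*-comm n m) ⟩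
    (m ℕ.* n) % p        ∎

  +-comm : ∀ a b → a + b ≡ b + a
  +-comm a b = cong (_mod p) (ℕ.+-comm (toℕ a) (toℕ b))

  *-comm : ∀ a b → a * b ≡ b * a
  *-comm a b = cong (_mod p) (ℕ.*-comm (toℕ a) (toℕ b))

  +-assoc : ∀ a b c → (a + b) + c ≡ a + (b + c)
  +-assoc a b c = toℕ-injective (begin
    toℕ ((a + b) + c)                      ≡⟨ toℕ-+ (a + b) c ⟩
    (toℕ (a + b) ℕ.+ z) % p                ≡⟨ cong (λ w → (w ℕ.+ z) % p) (toℕ-+ a b) ⟩
    ((x ℕ.+ y) % p ℕ.+ z) % p              ≡⟨ %-absorbˡ-+ (x ℕ.+ y) z ⟩
    (x ℕ.+ y ℕ.+ z) % p                    ≡⟨ cong (_% p) (ℕ.+-assoc x y z) ⟩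
    (x ℕ.+ (y ℕ.+ z)) % p                  ≡⟨ %-absorbʳ-+ x (y ℕ.+ z) ⟨
    (x ℕ.+ (y ℕ.+ z) % p) % p              ≡⟨ cong (λ w → (x ℕ.+ w) % p) (toℕ-+ b c) ⟨
    (x ℕ.+ toℕ (b + c)) % p                ≡⟨ toℕ-+ a (b + c) ⟨
    toℕ (a + (b + c))                      ∎)
    where x = toℕ a; y = toℕ b; z = toℕ c

  *-assoc : ∀ a b c → (a * b) * c ≡ a * (b * c)
  *-assoc a b c = toℕ-injective (begin
    toℕ ((a * b) * c)                      ≡⟨ toℕ-* (a * b) c ⟩
    (toℕ (a * b) ℕ.* z) % p                ≡⟨ cong (λ w → (w ℕ.* z) % p) (toℕ-* a b) ⟩
    ((x ℕ.* y) % p ℕ.* z) % p              ≡⟨ %-absorbˡ-* (x ℕ.* y) z ⟩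
    (x ℕ.* y ℕ.* z) % p                    ≡⟨ cong (_% p) (ℕ.*-assoc x y z) ⟩
    (x ℕ.* (y ℕ.* z)) % p                  ≡⟨ %-absorbʳ-* x (y ℕ.* z) ⟨
    (x ℕ.* ((y ℕ.* z) % p)) % p            ≡⟨ cong (λ w → (x ℕ.* w) % p) (toℕ-* b c) ⟨
    (x ℕ.* toℕ (b * c)) % p                ≡⟨ toℕ-* a (b * c) ⟨
    toℕ (a * (b * c))                      ∎)
    where x = toℕ a; y = toℕ b; z = toℕ c

  *-distribʳ-+ : ∀ a b c → (b + c) * a ≡ b * a + c * a
  *-distribʳ-+ a b c = toℕ-injective (begin
    toℕ ((b + c) * a)                      ≡⟨ toℕ-* (b + c) a ⟩
    (toℕ (b + c) ℕ.* x) % p                ≡⟨ cong (λ w → (w ℕ.* x) % p) (toℕ-+ b c) ⟩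
    ((y ℕ.+ z) % p ℕ.* x) % p              ≡⟨ %-absorbˡ-* (y ℕ.+ z) x ⟩
    ((y ℕ.+ z) ℕ.* x) % p                  ≡⟨ cong (_% p) (ℕ.*-distribʳ-+ x y z) ⟩
    (y ℕ.* x ℕ.+ z ℕ.* x) % p              ≡⟨ %-distribˡ-+ (y ℕ.* x) (z ℕ.* x) p ⟩
    ((y ℕ.* x) % p ℕ.+ (z ℕ.* x) % p) % p  ≡⟨ cong₂ (λ v w → (v ℕ.+ w) % p) (toℕ-* b a) (toℕ-* c a) ⟨
    (toℕ (b * a) ℕ.+ toℕ (c * a)) % p      ≡⟨ toℕ-+ (b * a) (c * a) ⟨
    toℕ (b * a + c * a)                    ∎)
    where x = toℕ a; y = toℕ b; z = toℕ c

  +-identityˡ : ∀ a → 0ₚ p + a ≡ a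
  +-identityˡ a = toℕ-injective (begin
    toℕ (0ₚ p + a)              ≡⟨ toℕ-+ (0ₚ p) a ⟩
    (toℕ (0ₚ p) ℕ.+ toℕ a) % p  ≡⟨ cong (λ x → (x ℕ.+ toℕ a) % p) toℕ-0ₚ ⟩
    toℕ a % p                   ≡⟨ toℕ-% a ⟩
    toℕ a                       ∎)

  *-identityˡ : ∀ a → 1ₚ p * a ≡ a
  *-identityˡ a = toℕ-injective (begin
    toℕ (1ₚ p * a)              ≡⟨ toℕ-* (1ₚ p) a ⟩
    (toℕ (1ₚ p) ℕ.* toℕ a) % p  ≡⟨ cong (λ x → (x ℕ.* toℕ a) % p) (toℕ-mod 1) ⟩
    (1 % p ℕ.* toℕ a) % p       ≡⟨ %-absorbˡ-* 1 (toℕ a) ⟩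
    (1 ℕ.* toℕ a) % p           ≡⟨ cong (_% p) (ℕ.*-identityˡ (toℕ a)) ⟩
    toℕ a % p                   ≡⟨ toℕ-% a ⟩
    toℕ a                       ∎)

  -‿inverseˡ : ∀ a → - a + a ≡ 0ₚ p
  -‿inverseˡ a = toℕ-injective (begin
    toℕ (- a + a)                    ≡⟨ toℕ-+ (- a) a ⟩
    (toℕ (- a) ℕ.+ toℕ a) % p        ≡⟨ cong (λ x → (x ℕ.+ toℕ a) % p) (toℕ-mod (p ∸ toℕ a)) ⟩
    ((p ∸ toℕ a) % p ℕ.+ toℕ a) % p  ≡⟨ %-absorbˡ-+ (p ∸ toℕ a) (toℕ a) ⟩
    (p ∸ toℕ a ℕ.+ toℕ a) % p        ≡⟨ cong (_% p) (ℕ.m∸n+n≡m (ℕ.<⇒≤ (toℕ<n a))) ⟩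
    p % p                            ≡⟨ n%n≡0 p ⟩
    0                                ≡⟨ toℕ-0ₚ ⟨
    toℕ (0ₚ p)                       ∎)

  isCommutativeRing : IsCommutativeRing _≡_ _+_ _*_ -_ (0ₚ p) (1ₚ p)
  isCommutativeRing = record
    { isRing = record
      { +-isAbelianGroup = record
        { isGroup = record
          { isMonoid = record
            { isSemigroup = record
              { isMagma = record { isEquivalence = isEquivalence ; ∙-cong = cong₂ _+_ }
              ; assoc = +-assoc }
            ; identity = comm∧idˡ⇒id +-comm +-identityˡ }
          ; inverse = comm∧invˡ⇒inv +-comm -‿inverseˡ
          ; ⁻¹-cong = cong -_ }
        ; comm = +-comm }
      ; *-cong = cong₂ _*_
      ; *-assoc = *-assoc
      ; *-identity = comm∧idˡ⇒id *-comm *-identityˡ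
      ; distrib = comm∧distrʳ⇒distr (cong₂ _+_) *-comm *-distribʳ-+ }
    ; *-comm = *-comm }

  commutativeRing : CommutativeRing 0ℓ 0ℓ
  commutativeRing = record { isCommutativeRing = isCommutativeRing }

  p∣toℕ⇒≡0ₚ : ∀ a → p ∣ toℕ a → a ≡ 0ₚ p
  p∣toℕ⇒≡0ₚ a p∣a = toℕ-injective (begin
    toℕ a       ≡⟨ toℕ-% a ⟨
    toℕ a % p   ≡⟨ n∣m⇒m%n≡0 (toℕ a) p p∣a ⟩
    0           ≡⟨ toℕ-0ₚ ⟨
    toℕ (0ₚ p)  ∎)

  *-integral : Prime p → ∀ {a b} → a * b ≡ 0ₚ p → a ≡ 0ₚ p ⊎ b ≡ 0ₚ p
  *-integral p-prime {a} {b} ab≡0 =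
    map (p∣toℕ⇒≡0ₚ a) (p∣toℕ⇒≡0ₚ b) (euclidsLemma (toℕ a) (toℕ b) p-prime p∣ab)
    where
    p∣ab : p ∣ toℕ a ℕ.* toℕ b
    p∣ab = m%n≡0⇒n∣m _ p (trans (sym (toℕ-* a b)) (trans (cong toℕ ab≡0) toℕ-0ₚ))

module LinearIndependence {r ℓ} (R : CommutativeRing r ℓ) where

  open CommutativeRing R
  open import Algebra.Properties.Semiring.Sum semiring
    using (sum; sum-cong-≋; sum-replicate-zero; ∑-distrib-+; *-distribˡ-sum; *-distribʳ-sum)
  open import Algebra.Properties.Ring ring using (-1*x≈-x; [y-z]x≈yx-zx)
  open import Algebra.Properties.Group +-group using (x∙y⁻¹≈ε⇒x≈y; ∙-cancelʳ)
  -- The coefficient test never succeeds, so this solver proves only identities needing no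
  -- cancellation.
  open import Algebra.Solver.Ring rawRing (fromCommutativeRing R) (-raw-almostCommutative⟶ _)
    (λ _ _ → nothing)
  open import Relation.Binary.Reasoning.Setoid setoid

  infixl 7 _·_

  _·_ : ∀ {k m} → Vector Carrier k → (Fin k → Vector Carrier m) → Vector Carrier m
  (c · u) j = sum (λ t → c t * u t j)

  Independent : ∀ {k m} → (Fin k → Vector Carrier m) → Set (r ⊔ ℓ)
  Independent u = ∀ c → (∀ j → (c · u) j ≈ 0#) → ∀ t → c t ≈ 0#

  NoZeroDivisors : Set (r ⊔ ℓ)
  NoZeroDivisors = ∀ {x y} → x * y ≈ 0# → x ≈ 0# ⊎ y ≈ 0#

  sum-zero : ∀ {k} {c : Vector Carrier k} → (∀ t → c t ≈ 0#) → sum c ≈ 0#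
  sum-zero {k} c≈0 = trans (sum-cong-≋ c≈0) (sum-replicate-zero k)

  sum-neg : ∀ {k} (c : Vector Carrier k) → sum (λ t → - c t) ≈ - sum c
  sum-neg c = begin
    sum (λ t → - c t)       ≈⟨ sum-cong-≋ (λ t → -1*x≈-x (c t)) ⟨
    sum (λ t → - 1# * c t)  ≈⟨ *-distribˡ-sum (- 1#) c ⟨
    - 1# * sum c            ≈⟨ -1*x≈-x (sum c) ⟩
    - sum c                 ∎

  sum-updateAt-0# : ∀ {k} (d : Vector Carrier k) i → sum d ≈ d i + sum (updateAt d i (const 0#))
  sum-updateAt-0# d Fin.zero = +-congˡ (sym (+-identityˡ _))
  sum-updateAt-0# d (Fin.suc i) = begin
    d₀ + sum (d ∘ Fin.suc)         ≈⟨ +-congˡ (sum-updateAt-0# (d ∘ Fin.suc) i) ⟩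
    d₀ + (d (Fin.suc i) + s)       ≈⟨ solve 3 (λ x y z → x :+ (y :+ z) := y :+ (x :+ z)) refl _ _ _ ⟩
    d (Fin.suc i) + (d₀ + s)       ∎
    where
    d₀ = d Fin.zero
    s = sum (updateAt (d ∘ Fin.suc) i (const 0#))

  ·-cong : ∀ {k m} {c d : Vector Carrier k} {u v : Fin k → Vector Carrier m} →
           (∀ t → c t ≈ d t) → (∀ t j → u t j ≈ v t j) → ∀ j → (c · u) j ≈ (d · v) j
  ·-cong c≈d u≈v j = sum-cong-≋ (λ t → *-cong (c≈d t) (u≈v t j))

  ·-zeroʳ : ∀ {k m} c (u : Fin k → Vector Carrier m) j → (∀ t → u t j ≈ 0#) → (c · u) j ≈ 0#
  ·-zeroʳ c u j u≈0 = sum-zero (λ t → trans (*-congˡ (u≈0 t)) (zeroʳ (c t)))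

  ·-scaleˡ : ∀ {k m} x c (u : Fin k → Vector Carrier m) j →
             ((λ t → x * c t) · u) j ≈ x * (c · u) j
  ·-scaleˡ x c u j =
    trans (sum-cong-≋ (λ t → *-assoc x (c t) (u t j))) (sym (*-distribˡ-sum x (λ t → c t * u t j)))

  ·-distrib-− : ∀ {k m} c d (u : Fin k → Vector Carrier m) j →
                ((λ t → c t - d t) · u) j ≈ (c · u) j - (d · u) j
  ·-distrib-− c d u j = begin
    sum (λ t → (c t - d t) * u t j)
      ≈⟨ sum-cong-≋ (λ t → [y-z]x≈yx-zx (u t j) (c t) (d t)) ⟩
    sum (λ t → c t * u t j + - (d t * u t j))
      ≈⟨ ∑-distrib-+ (λ t → c t * u t j) (λ t → - (d t * u t j)) ⟩
    (c · u) j + sum (λ t → - (d t * u t j))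
      ≈⟨ +-congˡ (sum-neg (λ t → d t * u t j)) ⟩
    (c · u) j - (d · u) j
      ∎

  Independent-resp : ∀ {k m} {u v : Fin k → Vector Carrier m} → (∀ t j → u t j ≈ v t j) →
                     Independent u → Independent v
  Independent-resp u≈v u-ind c c·v≈0 =
    u-ind c (λ j → trans (·-cong (λ _ → refl) u≈v j) (c·v≈0 j))

  Independent-reindex : ∀ {k m m′} {u : Fin k → Vector Carrier m}
                        (π : Fin m′ → Fin m) (π⁻¹ : Fin m → Fin m′) → (∀ j → π (π⁻¹ j) ≡ j) →
                        Independent u → Independent (λ t → u t ∘ π)
  Independent-reindex {u = u} π π⁻¹ π∘π⁻¹ u-ind c c·uπ≈0 = u-ind c λ j →
    trans (sum-cong-≋ (λ t → *-congˡ (reflexive (≡.cong (u t) (≡.sym (π∘π⁻¹ j))))))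
          (c·uπ≈0 (π⁻¹ j))

  Independent⇒·-injective : ∀ {k m} {u : Fin k → Vector Carrier m} → Independent u →
                            ∀ {c d} → (∀ j → (c · u) j ≈ (d · u) j) → ∀ t → c t ≈ d t
  Independent⇒·-injective {u = u} u-ind {c} {d} c·u≈d·u t =
    x∙y⁻¹≈ε⇒x≈y (c t) (d t) (u-ind (λ t → c t - d t) c-d·u≈0 t)
    where
    c-d·u≈0 : ∀ j → ((λ t → c t - d t) · u) j ≈ 0#
    c-d·u≈0 j = begin
      ((λ t → c t - d t) · u) j  ≈⟨ ·-distrib-− c d u j ⟩
      (c · u) j - (d · u) j      ≈⟨ +-congʳ (c·u≈d·u j) ⟩
      (d · u) j - (d · u) j      ≈⟨ -‿inverseʳ _ ⟩
      0#                         ∎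

  Independent-∘suc : ∀ {k m} {u : Fin (suc k) → Vector Carrier m} →
                     Independent u → Independent (u ∘ Fin.suc)
  Independent-∘suc {u = u} u-ind c c·u≈0 t = u-ind (0# ∷ c) 0∷c·u≈0 (Fin.suc t)
    where
    0∷c·u≈0 : ∀ j → ((0# ∷ c) · u) j ≈ 0#
    0∷c·u≈0 j = trans (trans (+-congʳ (zeroˡ (u Fin.zero j))) (+-identityˡ _)) (c·u≈0 j)

  independent-subfamily : ∀ {k r m} {u : Fin r → Vector Carrier m} → k ≤′ r → Independent u →
                          Σ[ h ∈ (Fin k → Fin r) ] Independent (u ∘ h)
  independent-subfamily ℕ.≤′-refl u-ind = (λ t → t) , u-ind
  independent-subfamily {u = u} (ℕ.≤′-step k≤r) u-ind
    with independent-subfamily {u = u ∘ Fin.suc} k≤r (Independent-∘suc {u = u} u-ind)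
  ... | h , uh-ind = Fin.suc ∘ h , uh-ind

  affine : ∀ {k m} → (Fin k → Vector Carrier m) → Vector Carrier k → Vector Carrier m →
           Fin k → Vector Carrier m
  affine u a β t j = u t j + a t + β j

  ·-affine : ∀ {k m} c (u : Fin k → Vector Carrier m) a β j →
             (c · affine u a β) j ≈ (c · u) j + sum (λ t → c t * a t) + sum c * β j
  ·-affine c u a β j = begin
    sum (λ t → c t * (u t j + a t + β j))
      ≈⟨ sum-cong-≋ (λ t → solve 4 (λ c u a b → c :* (u :+ a :+ b) := c :* u :+ c :* a :+ c :* b)
                                   refl (c t) (u t j) (a t) (β j)) ⟩
    sum (λ t → c t * u t j + c t * a t + c t * β j)
      ≈⟨ ∑-distrib-+ (λ t → c t * u t j + c t * a t) (λ t → c t * β j) ⟩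
    sum (λ t → c t * u t j + c t * a t) + sum (λ t → c t * β j)
      ≈⟨ +-cong (∑-distrib-+ (λ t → c t * u t j) (λ t → c t * a t)) (sym (*-distribʳ-sum (β j) c)) ⟩
    (c · u) j + sum (λ t → c t * a t) + sum c * β j
      ∎

  affine-dependency : ∀ {k m} {u : Fin k → Vector Carrier m} {j₀} → (∀ t → u t j₀ ≈ 0#) →
                      ∀ {a β c} → (∀ j → (c · affine u a β) j ≈ 0#) →
                      ∀ j → (c · u) j + sum c * β j ≈ sum c * β j₀
  affine-dependency {u = u} {j₀} u-j₀ {a} {β} {c} c-dep j = ∙-cancelʳ A _ _ (begin
    S j + C * β j + A    ≈⟨ solve 3 (λ S x A → S :+ x :+ A := S :+ A :+ x) refl (S j) (C * β j) A ⟩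
    S j + A + C * β j    ≈⟨ E j ⟩
    0#                   ≈⟨ E j₀ ⟨
    S j₀ + A + C * β j₀  ≈⟨ +-congʳ (+-congʳ (·-zeroʳ c u j₀ u-j₀)) ⟩
    0# + A + C * β j₀    ≈⟨ +-congʳ (+-identityˡ A) ⟩
    A + C * β j₀         ≈⟨ +-comm A (C * β j₀) ⟩
    C * β j₀ + A         ∎)
    where
    S = c · u
    A = sum (λ t → c t * a t)
    C = sum c
    E : ∀ j → S j + A + C * β j ≈ 0#
    E j = trans (sym (·-affine c u a β j)) (c-dep j)

  module Exchange (integral : NoZeroDivisors)
    {k m} {u : Fin k → Vector Carrier m} (u-ind : Independent u) {j₀} (u-j₀ : ∀ t → u t j₀ ≈ 0#)
    {a β c} (c-dep : ∀ j → (c · affine u a β) j ≈ 0#) {t₀} (c-t₀ : c t₀ ≉ 0#) where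

    private
      C = sum c

    sum≉0 : C ≉ 0#
    sum≉0 C≈0 = c-t₀ (u-ind c c·u≈0 t₀)
      where
      Cx≈0 : ∀ x → C * x ≈ 0#
      Cx≈0 x = trans (*-congʳ C≈0) (zeroˡ x)
      c·u≈0 : ∀ j → (c · u) j ≈ 0#
      c·u≈0 j = begin
        (c · u) j            ≈⟨ +-identityʳ _ ⟨
        (c · u) j + 0#       ≈⟨ +-congˡ (Cx≈0 (β j)) ⟨
        (c · u) j + C * β j  ≈⟨ affine-dependency u-j₀ c-dep j ⟩
        C * β j₀             ≈⟨ Cx≈0 (β j₀) ⟩
        0#                   ∎

    module _ {u′ : Fin k → Vector Carrier m} (u′-t₀ : ∀ j → u′ t₀ j ≈ 0#)
             (u′≈u : ∀ t → t ≢ t₀ → ∀ j → u′ t j ≈ u t j) (a′ : Vector Carrier k) where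

      u′-j₀ : ∀ t → u′ t j₀ ≈ 0#
      u′-j₀ t with t Fin.≟ t₀
      ... | yes ≡.refl = u′-t₀ j₀
      ... | no t≢t₀ = trans (u′≈u t t≢t₀ j₀) (u-j₀ t)

      module _ {d : Vector Carrier k} (d-dep : ∀ j → (d · affine u′ a′ β) j ≈ 0#) where

        private
          D = sum d
          d′ = updateAt d t₀ (const 0#)

        d·u′≈d′·u : ∀ j → (d · u′) j ≈ (d′ · u) j
        d·u′≈d′·u j = sum-cong-≋ termwise
          where
          termwise : ∀ t → d t * u′ t j ≈ d′ t * u t j
          termwise t with t Fin.≟ t₀
          ... | yes ≡.refl = begin
            d t₀ * u′ t₀ j  ≈⟨ *-congˡ (u′-t₀ j) ⟩
            d t₀ * 0#       ≈⟨ zeroʳ _ ⟩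
            0#              ≈⟨ zeroˡ _ ⟨
            0# * u t₀ j     ≈⟨ *-congʳ (reflexive (updateAt-updates t₀ d)) ⟨
            d′ t₀ * u t₀ j  ∎
          ... | no t≢t₀ =
            *-cong (reflexive (≡.sym (updateAt-minimal t t₀ d t≢t₀))) (u′≈u t t≢t₀ j)

        -- After adding C D β_j both sides equal C D β_{j₀}, by affine-dependency for d and for c.
        Cd′≈Dc : ∀ t → C * d′ t ≈ D * c t
        Cd′≈Dc = Independent⇒·-injective u-ind λ j → ∙-cancelʳ (C * (D * β j)) _ _ (begin
          ((λ t → C * d′ t) · u) j + C * (D * β j)  ≈⟨ +-congʳ (·-scaleˡ C d′ u j) ⟩
          C * (d′ · u) j + C * (D * β j)            ≈⟨ +-congʳ (*-congˡ (d·u′≈d′·u j)) ⟨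
          C * (d · u′) j + C * (D * β j)            ≈⟨ distribˡ C _ _ ⟨
          C * ((d · u′) j + D * β j)                ≈⟨ *-congˡ (affine-dependency u′-j₀ d-dep j) ⟩
          C * (D * β j₀)                            ≈⟨ solve 3 (λ C D b → C :* (D :* b) := D :* (C :* b))
                                                               refl C D (β j₀) ⟩
          D * (C * β j₀)                            ≈⟨ *-congˡ (affine-dependency u-j₀ c-dep j) ⟨
          D * ((c · u) j + C * β j)                 ≈⟨ solve 4 (λ C D S b → D :* (S :+ C :* b)
                                                                        := D :* S :+ C :* (D :* b))
                                                               refl C D ((c · u) j) (β j) ⟩
          D * (c · u) j + C * (D * β j)             ≈⟨ +-congʳ (·-scaleˡ D c u j) ⟨
          ((λ t → D * c t) · u) j + C * (D * β j)   ∎)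

        Dc-t₀≈0 : D * c t₀ ≈ 0#
        Dc-t₀≈0 = begin
          D * c t₀   ≈⟨ Cd′≈Dc t₀ ⟨
          C * d′ t₀  ≈⟨ *-congˡ (reflexive (updateAt-updates t₀ d)) ⟩
          C * 0#     ≈⟨ zeroʳ C ⟩
          0#         ∎

        D≈0 : D ≈ 0#
        D≈0 with integral Dc-t₀≈0
        ... | inj₁ D≈0 = D≈0
        ... | inj₂ c-t₀≈0 = ⊥-elim (c-t₀ c-t₀≈0)

        d′≈0 : ∀ t → d′ t ≈ 0#
        d′≈0 t with integral (trans (Cd′≈Dc t) (trans (*-congʳ D≈0) (zeroˡ (c t))))
        ... | inj₁ C≈0 = ⊥-elim (sum≉0 C≈0)
        ... | inj₂ d′t≈0 = d′t≈0

        d≈0 : ∀ t → d t ≈ 0#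
        d≈0 t with t Fin.≟ t₀
        ... | yes ≡.refl = begin
          d t₀           ≈⟨ +-identityʳ _ ⟨
          d t₀ + 0#      ≈⟨ +-congˡ (sum-zero d′≈0) ⟨
          d t₀ + sum d′  ≈⟨ sum-updateAt-0# d t₀ ⟨
          D              ≈⟨ D≈0 ⟩
          0#             ∎
        ... | no t≢t₀ = trans (reflexive (≡.sym (updateAt-minimal t t₀ d t≢t₀))) (d′≈0 t)

      exchange : Independent (affine u′ a′ β)
      exchange d d-dep = d≈0 d-dep

  affine-independent : NoZeroDivisors → Decidable _≈_ →
    ∀ {k m} {u : Fin k → Vector Carrier m} → Independent u → ∀ {j₀} → (∀ t → u t j₀ ≈ 0#) →
    (u′ : Fin k → Fin k → Vector Carrier m) → (∀ t₀ j → u′ t₀ t₀ j ≈ 0#) →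
    (∀ t₀ t → t ≢ t₀ → ∀ j → u′ t₀ t j ≈ u t j) →
    ∀ {a β} (a′ : Fin k → Vector Carrier k) →
    (∀ t₀ → ¬ Independent (affine (u′ t₀) (a′ t₀) β)) → Independent (affine u a β)
  affine-independent integral _≟_ u-ind u-j₀ u′ u′-t₀ u′≈u a′ u′-dep c c-dep t with c t ≟ 0#
  ... | yes c-t≈0 = c-t≈0
  ... | no c-t≉0 = ⊥-elim (u′-dep t
    (Exchange.exchange integral u-ind u-j₀ c-dep c-t≉0 (u′-t₀ t) (u′≈u t) (a′ t)))

module _ {p : ℕ} .{{_ : NonZero p}} where

  open ℤ/ p using (_+_; _*_; commutativeRing; *-integral)
  open CommutativeRing commutativeRing using (+-identityʳ; semiring; commutativeSemiring)
  open LinearIndependence commutativeRing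
  open import Algebra.Properties.Semiring.Sum semiring using (sum)
  open import Algebra.Solver.Ring.NaturalCoefficients.Default commutativeSemiring
    using (solve; _:+_; _:=_)

  sumₚ≡sum : ∀ {k} (f : Vector (Fin p) k) → sumₚ p f ≡ sum f
  sumₚ≡sum {zero} f = ≡.refl
  sumₚ≡sum {suc k} f = ≡.cong (f Fin.zero +_) (sumₚ≡sum (f ∘ Fin.suc))

  rowsIndependent⇒independent : ∀ {n k} (L : Matrix p n) (f : Fin k → Fin n) →
                                RowsIndependent p L f → Independent (L ∘ f)
  rowsIndependent⇒independent L f f-ind c c·Lf≈0 =
    f-ind c (λ j → ≡.trans (sumₚ≡sum (λ t → c t * L (f t) j)) (c·Lf≈0 j))

  independent⇒rowsIndependent : ∀ {n k} (L : Matrix p n) (f : Fin k → Fin n) →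
                                Independent (L ∘ f) → RowsIndependent p L f
  independent⇒rowsIndependent L f Lf-ind c c·Lf≡0 =
    Lf-ind c (λ j → ≡.trans (≡.sym (sumₚ≡sum (λ t → c t * L (f t) j))) (c·Lf≡0 j))

  record PermutedShift {n} (L M : Matrix p n) : Set where
    field
      σ τ : Permutation′ n
      α β : Vector (Fin p) n
      entry : ∀ r c → M r c ≡ L (σ ⟨$⟩ʳ r) (τ ⟨$⟩ʳ c) + α r + β c

  shiftRow : ∀ b l a β {x} → x ≡ l + a + β →
             (if b then x + 1ₚ p else x) ≡ l + (if b then a + 1ₚ p else a) + β
  shiftRow true l a β ≡.refl =
    solve 4 (λ l a β o → l :+ a :+ β :+ o := l :+ (a :+ o) :+ β) ≡.refl l a β (1ₚ p)
  shiftRow false _ _ _ x≡ = x≡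

  shiftCol : ∀ b l a β {x} → x ≡ l + a + β →
             (if b then x + 1ₚ p else x) ≡ l + a + (if b then β + 1ₚ p else β)
  shiftCol true l a β ≡.refl =
    solve 4 (λ l a β o → l :+ a :+ β :+ o := l :+ a :+ (β :+ o)) ≡.refl l a β (1ₚ p)
  shiftCol false _ _ _ x≡ = x≡

  permutedShift-refl : ∀ {n} (L : Matrix p n) → PermutedShift L L
  permutedShift-refl L = record
    { σ = Permutation.id ; τ = Permutation.id ; α = const (0ₚ p) ; β = const (0ₚ p)
    ; entry = λ r c → ≡.sym (≡.trans (+-identityʳ _) (+-identityʳ _)) }

  permutedShift-step : ∀ {n} {L M N : Matrix p n} → PermutedShift L M → Step p M N →
                       PermutedShift L N
  permutedShift-step S (addRow i N≡) = record
    { σ = σ ; τ = τ ; α = λ r → if ⌊ r Fin.≟ i ⌋ then α r + 1ₚ p else α r ; β = β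
    ; entry = λ r c → ≡.trans (N≡ r c) (shiftRow ⌊ r Fin.≟ i ⌋ _ (α r) (β c) (entry r c)) }
    where open PermutedShift S
  permutedShift-step S (addCol j N≡) = record
    { σ = σ ; τ = τ ; α = α ; β = λ c → if ⌊ c Fin.≟ j ⌋ then β c + 1ₚ p else β c
    ; entry = λ r c → ≡.trans (N≡ r c) (shiftCol ⌊ c Fin.≟ j ⌋ _ (α r) (β c) (entry r c)) }
    where open PermutedShift S
  permutedShift-step S (permRows ρ N≡) = record
    { σ = ρ ∘ₚ σ ; τ = τ ; α = α ∘ (ρ ⟨$⟩ʳ_) ; β = β
    ; entry = λ r c → ≡.trans (N≡ r c) (entry (ρ ⟨$⟩ʳ r) c) }
    where open PermutedShift S
  permutedShift-step S (permCols ρ N≡) = record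
    { σ = σ ; τ = ρ ∘ₚ τ ; α = α ; β = β ∘ (ρ ⟨$⟩ʳ_)
    ; entry = λ r c → ≡.trans (N≡ r c) (entry r (ρ ⟨$⟩ʳ c)) }
    where open PermutedShift S

  equivalent⇒permutedShift : ∀ {n} {L M : Matrix p n} → Equivalent p L M → PermutedShift L M
  equivalent⇒permutedShift {L = L} = go (permutedShift-refl L)
    where
    go : ∀ {M N} → PermutedShift L M → Equivalent p M N → PermutedShift L N
    go S ε = S
    go S (step ◅ steps) = go (permutedShift-step S step) steps

  origin : ∀ {n} → Fin n → Fin n
  origin {suc n} _ = Fin.zero

  toℕ-origin : ∀ {n} (i : Fin n) → toℕ (origin i) ≡ 0
  toℕ-origin {suc n} _ = ≡.refl

  module PermutedRows {n k} {L M : Matrix p n} (L-dephased : Dephased p L)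
    (S : PermutedShift L M) (g : Fin (suc k) → Fin n) where

    open PermutedShift S

    σ⁻¹ : Fin n → Fin n
    σ⁻¹ = σ ⟨$⟩ˡ_

    o : Fin n
    o = origin (g Fin.zero)

    u : Fin (suc k) → Vector (Fin p) n
    u t c = L (g t) (τ ⟨$⟩ʳ c)

    u-j₀ : ∀ t → u t (τ ⟨$⟩ˡ o) ≡ 0ₚ p
    u-j₀ t = ≡.trans (≡.cong (L (g t)) (inverseʳ τ)) (proj₂ (L-dephased (g t) o) (toℕ-origin _))

    rows-affine : ∀ t c → affine u (α ∘ σ⁻¹ ∘ g) β t c ≡ M (σ⁻¹ (g t)) c
    rows-affine t c = ≡.sym (≡.trans (entry (σ⁻¹ (g t)) c)
      (≡.cong (λ i → L i (τ ⟨$⟩ʳ c) + α (σ⁻¹ (g t)) + β c) (inverseʳ σ)))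

    exchanged : Fin (suc k) → Fin (suc k) → Fin n
    exchanged t₀ = updateAt (σ⁻¹ ∘ g) t₀ (const (σ⁻¹ o))

    u′ : Fin (suc k) → Fin (suc k) → Vector (Fin p) n
    u′ t₀ t c = L (σ ⟨$⟩ʳ exchanged t₀ t) (τ ⟨$⟩ʳ c)

    u′-t₀ : ∀ t₀ c → u′ t₀ t₀ c ≡ 0ₚ p
    u′-t₀ t₀ c = begin
      u′ t₀ t₀ c                   ≡⟨ ≡.cong (λ i → L (σ ⟨$⟩ʳ i) (τ ⟨$⟩ʳ c)) (updateAt-updates t₀ (σ⁻¹ ∘ g)) ⟩
      L (σ ⟨$⟩ʳ σ⁻¹ o) (τ ⟨$⟩ʳ c)  ≡⟨ ≡.cong (λ i → L i (τ ⟨$⟩ʳ c)) (inverseʳ σ) ⟩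
      L o (τ ⟨$⟩ʳ c)               ≡⟨ proj₁ (L-dephased o _) (toℕ-origin _) ⟩
      0ₚ p                         ∎
      where open ≡.≡-Reasoning

    u′≈u : ∀ t₀ t → t ≢ t₀ → ∀ c → u′ t₀ t c ≡ u t c
    u′≈u t₀ t t≢t₀ c =
      ≡.trans (≡.cong (λ i → L (σ ⟨$⟩ʳ i) (τ ⟨$⟩ʳ c)) (updateAt-minimal t t₀ (σ⁻¹ ∘ g) t≢t₀))
              (≡.cong (λ i → L i (τ ⟨$⟩ʳ c)) (inverseʳ σ))

    exchanged-affine : ∀ t₀ t c → affine (u′ t₀) (α ∘ exchanged t₀) β t c ≡ M (exchanged t₀ t) c
    exchanged-affine t₀ t c = ≡.sym (entry (exchanged t₀ t) c)

  rowsDependent-pullback : Prime p → ∀ {n k} {L M : Matrix p n} → Dephased p L →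
    PermutedShift L M → (∀ (h : Fin (suc k) → Fin n) → ¬ RowsIndependent p M h) →
    ∀ g → ¬ RowsIndependent p L g
  rowsDependent-pullback p-prime {L = L} {M} L-dephased S M-dep g g-ind =
    M-dep (σ⁻¹ ∘ g) (independent⇒rowsIndependent M (σ⁻¹ ∘ g) (Independent-resp rows-affine rows-ind))
    where
    open PermutedShift S
    open PermutedRows L-dephased S g

    u-ind : Independent u
    u-ind = Independent-reindex {u = L ∘ g} (τ ⟨$⟩ʳ_) (τ ⟨$⟩ˡ_) (λ _ → inverseʳ τ)
      (rowsIndependent⇒independent L g g-ind)

    exchanged-dep : ∀ t₀ → ¬ Independent (affine (u′ t₀) (α ∘ exchanged t₀) β)
    exchanged-dep t₀ ind = M-dep (exchanged t₀) (independent⇒rowsIndependent M (exchanged t₀)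
      (Independent-resp {u = affine (u′ t₀) (α ∘ exchanged t₀) β} (exchanged-affine t₀) ind))

    rows-ind : Independent (affine u (α ∘ σ⁻¹ ∘ g) β)
    rows-ind = affine-independent (*-integral p-prime) Fin._≟_ u-ind u-j₀ u′ u′-t₀ u′≈u
      {a = α ∘ σ⁻¹ ∘ g} (λ t₀ → α ∘ exchanged t₀) exchanged-dep

  rank-≤ : Prime p → ∀ {n} {L M : Matrix p n} → Dephased p L → PermutedShift L M →
           ∀ {r s} → IsRank p L r → IsRank p M s → r ≤ s
  rank-≤ p-prime {L = L} L-dephased S {r} {s} ((f , f-ind) , _) (_ , M-dep) with r ≤? s
  ... | yes r≤s = r≤s
  ... | no r≰s
    with independent-subfamily (ℕ.≤⇒≤′ (ℕ.≰⇒> r≰s)) (rowsIndependent⇒independent L f f-ind)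
  ... | g , g-ind = ⊥-elim (rowsDependent-pullback p-prime L-dephased S M-dep
                              (f ∘ g) (independent⇒rowsIndependent L (f ∘ g) g-ind))

proposition4p3 : (p : ℕ) .{{_ : NonZero p}} → Prime p →
    ∀ {n} (L : Matrix p n) → IsLogHadamard p L → Dephased p L →
    ∀ (M : Matrix p n) → IsLogHadamard p M → Equivalent p L M →
    ∀ r s → IsRank p L r → IsRank p M s → r ≤ s
proposition4p3 p p-prime L _ L-dephased M _ L∼M r s =
  rank-≤ p-prime L-dephased (equivalent⇒permutedShift L∼M)
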